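{- For $N\ge 0$ let $a_N$ be the number of tilings of the $2\times 3\times \tfrac{2N}{3}$ box by $1\times2\times 2$ bricks when $2N/3$ is a positive integer, $a_N=0$ when $2N/3$ is not an integer, and $a_0=1$. Then $$\sum_{N\ge 0} a_N z^N=\frac{1-2z^3}{(1-z^3)(1-6z^3)}=1+5z^3+29z^6+173z^9+1037z^{12}+\cdots.$$
   Context: A tiling of a $k\times m\times n$ box (made of $kmn$ unit cubes) by $t_1\times t_2\times t_3$ bricks is a set of non-overlapping axis-parallel boxes with integer corners, each congruent to the brick (i.e. of dimensions some permutation of $(t_1,t_2,t_3)$; all orientations may be mixed), whose union is the box. Tilings related by a symmetry of the box are counted separately. $N$ is the number of bricks used. -}

module Defs where

open import Data.Bool using (Bool; true; false; _∧_; _∨_; not; if_then_else_)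
open import Data.Nat using (ℕ; zero; suc; _+_; _*_; _∸_; _<ᵇ_; _≡ᵇ_; _/_; _%_)
open import Data.Integer as ℤ using (ℤ; +_; -_)
open import Data.List using (List; []; _∷_; length; map; concatMap; upTo; foldr; filter)
open import Data.Vec using (Vec; []; _∷_)
open import Data.Fin using (Fin)
open import Data.Product using (_×_; _,_)

-- Axis-parallel boxes with integer corners inside the k × m × n box
-- [0,k] × [0,m] × [0,n].  A box is given by its two opposite corners
-- (x0,y0,z0) and (x1,y1,z1) with x0 < x1, y0 < y1, z0 < z1.

record Box : Set where
  constructor box
  field
    x0 x1 y0 y1 z0 z1 : ℕ

all : {A : Set} → (A → Bool) → List A → Bool
all p []       = true
all p (x ∷ xs) = p x ∧ all p xs

-- all pairs (a , b) with a < b ≤ k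
intervals : ℕ → List (ℕ × ℕ)
intervals k = concatMap (λ a → map (λ d → (a , a + suc d)) (upTo (k ∸ a))) (upTo k)

-- every axis-parallel box with integer corners contained in the big box,
-- each listed exactly once
candidates : ℕ → ℕ → ℕ → List Box
candidates k m n =
  concatMap (λ { (x0 , x1) →
  concatMap (λ { (y0 , y1) →
  map (λ { (z0 , z1) → box x0 x1 y0 y1 z0 z1 }) (intervals n) }) (intervals m) }) (intervals k)

isPermOf : ℕ → ℕ → ℕ → ℕ → ℕ → ℕ → Bool
isPermOf d1 d2 d3 t1 t2 t3 =
     ((d1 ≡ᵇ t1) ∧ (d2 ≡ᵇ t2) ∧ (d3 ≡ᵇ t3))
  ∨ ((d1 ≡ᵇ t1) ∧ (d2 ≡ᵇ t3) ∧ (d3 ≡ᵇ t2))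
  ∨ ((d1 ≡ᵇ t2) ∧ (d2 ≡ᵇ t1) ∧ (d3 ≡ᵇ t3))
  ∨ ((d1 ≡ᵇ t2) ∧ (d2 ≡ᵇ t3) ∧ (d3 ≡ᵇ t1))
  ∨ ((d1 ≡ᵇ t3) ∧ (d2 ≡ᵇ t1) ∧ (d3 ≡ᵇ t2))
  ∨ ((d1 ≡ᵇ t3) ∧ (d2 ≡ᵇ t2) ∧ (d3 ≡ᵇ t1))

congruent : ℕ → ℕ → ℕ → Box → Bool
congruent t1 t2 t3 (box x0 x1 y0 y1 z0 z1) = isPermOf (x1 ∸ x0) (y1 ∸ y0) (z1 ∸ z0) t1 t2 t3

-- the box contains the unit cube [i,i+1] × [j,j+1] × [l,l+1]
containsCell : Box → ℕ → ℕ → ℕ → Bool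
containsCell (box x0 x1 y0 y1 z0 z1) i j l =
  (not (i <ᵇ x0)) ∧ (i <ᵇ x1) ∧ (not (j <ᵇ y0)) ∧ (j <ᵇ y1) ∧ (not (l <ᵇ z0)) ∧ (l <ᵇ z1)

selected : {M : ℕ} → List Box → Vec Bool M → List Box
selected []       _             = []
selected (_ ∷ _)  []            = []
selected (b ∷ bs) (true  ∷ v)   = b ∷ selected bs v
selected (b ∷ bs) (false ∷ v)   = selected bs v

count : {A : Set} → (A → Bool) → List A → ℕ
count p xs = length (filter (λ x → p x Data.Bool.≟ true) xs)
  where import Data.Bool

-- a set S of boxes (a subset of the candidates) is a tiling of the
-- k × m × n box by t1 × t2 × t3 bricks iff every member is congruent to
-- the brick and every unit cube of the big box lies in exactly one member
-- (for integer boxes: non-overlapping interiors + union = whole box).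
isTiling : ℕ → ℕ → ℕ → ℕ → ℕ → ℕ → List Box → Bool
isTiling k m n t1 t2 t3 S =
  all (congruent t1 t2 t3) S ∧
  all (λ i → all (λ j → all (λ l → count (λ b → containsCell b i j l) S ≡ᵇ 1)
                                    (upTo n)) (upTo m)) (upTo k)

allVecs : (M : ℕ) → List (Vec Bool M)
allVecs zero    = [] ∷ []
allVecs (suc M) = concatMap (λ v → (true ∷ v) ∷ (false ∷ v) ∷ []) (allVecs M)

numTilings : ℕ → ℕ → ℕ → ℕ → ℕ → ℕ → ℕ
numTilings k m n t1 t2 t3 =
  count (λ v → isTiling k m n t1 t2 t3 (selected cs v)) (allVecs (length cs))
  where cs = candidates k m n

-- The sequence a_N of the theorem:
--   a_0 = 1,
--   a_N = #tilings of 2 × 3 × (2N/3) by 1 × 2 × 2 bricks if 2N/3 ∈ ℤ_{>0},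
--   a_N = 0 otherwise.   (For N > 0, 2N/3 ∈ ℤ iff N % 3 = 0, and then 2N/3 = 2 (N/3).)

a : ℕ → ℕ
a zero    = 1
a (suc N) = if (suc N % 3) ≡ᵇ 0
              then numTilings 2 3 (2 * (suc N / 3)) 1 2 2
              else 0

-- Formal power series over ℤ (coefficient functions ℕ → ℤ) and
-- polynomials (coefficient lists, constant term first).

Series : Set
Series = ℕ → ℤ

Poly : Set
Poly = List ℤ

coeffP : Poly → ℕ → ℤ
coeffP []       _       = + 0
coeffP (c ∷ _)  zero    = c
coeffP (_ ∷ cs) (suc i) = coeffP cs i

cauchy : Series → Series → ℕ → ℤ
cauchy f g N = foldr ℤ._+_ (+ 0) (map (λ i → f i ℤ.* g (N ∸ i)) (upTo (suc N)))

polyMul : Poly → Poly → Poly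
polyMul p q = map (cauchy (coeffP p) (coeffP q)) (upTo (length p + length q))

_·ₛ_ : Poly → Series → Series
p ·ₛ f = cauchy (coeffP p) f

genA : Series
genA N = + (a N)

oneMinusZ3 oneMinus6Z3 oneMinus2Z3 : Poly
oneMinusZ3  = + 1 ∷ + 0 ∷ + 0 ∷ - (+ 1) ∷ []
oneMinus6Z3 = + 1 ∷ + 0 ∷ + 0 ∷ - (+ 6) ∷ []
oneMinus2Z3 = + 1 ∷ + 0 ∷ + 0 ∷ - (+ 2) ∷ []

-- Transfer matrix along the long side. Cut a tiling of the 2 × 3 × n box into the bricks meeting the
-- bottom layer, which lie in the two lowest layers, and the rest, which tiles the box above layer 0
-- except for the cells of layer 1 already taken from below. Recording these cells as a profile, the
-- profiles reachable from the empty one are: empty (E), full (U), one end strip (S₀, S₂) and two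
-- adjacent strips (S₀₁, S₁₂), and one layer up
--   E → 3U + S₀ + S₂,  U → E,  S₀ → 2S₁₂ + E,  S₂ → 2S₀₁ + E,  S₀₁ → S₂,  S₁₂ → S₀.
-- Eliminating gives T(n+4) = 7 T(n+2) − 6 T(n) for the tiling counts T, with T(0) = 1, T(2) = 5.
-- As a_N vanishes unless 3 ∣ N and a_{3q} = T(2q), also a_{N+6} = 7 a_{N+3} − 6 a_N, which with
-- the initial values 1, 0, 0, 5, 0, 0 is the claimed identity of power series.
module Submission where

open import Defs
open import Algebra.Bundles using (CommutativeMonoid)
import Algebra.Properties.CommutativeSemigroup as CommutativeSemigroupProperties
open import Data.Bool using (Bool; true; false; T; _∧_; not; if_then_else_)
open import Data.Bool.Properties using (∧-zeroʳ; ∧-commutativeMonoid)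
open import Data.Integer as ℤ using (ℤ; +_; -_)
import Data.Integer.Properties as ℤ
import Data.Integer.Tactic.RingSolver as ℤ-Solver
open import Data.List using (List; []; _∷_; _++_; map; concatMap; filter; filterᵇ; foldr; length; upTo; applyUpTo)
open import Data.List.Properties
  using (++-assoc; length-++; filter-++; filter-none; map-++; map-∘; map-cong-local; map-applyUpTo;
         concatMap-cong; concatMap-map; map-concatMap)
open import Data.List.Relation.Unary.All as All using (All; []; _∷_; universal)
open import Data.List.Relation.Unary.All.Properties using (map⁺; concat⁺; filter⁺; applyUpTo⁺₂; all-upTo)
open import Data.List.Relation.Binary.Permutation.Propositional as ↭
  using (_↭_; ↭-reflexive; ↭-trans; module PermutationReasoning)
open import Data.List.Relation.Binary.Permutation.Propositional.Properties
  using (↭-length; filter-↭; ++⁺; ++⁺ˡ; shifts)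
open import Data.Nat using (ℕ; zero; suc; _+_; _*_; _∸_; _≤_; _<ᵇ_; _≡ᵇ_; _≤ᵇ_; _%_; _/_)
open import Data.Nat.DivMod using ([m+kn]%n≡m%n; m*n%n≡0; m*n/n≡m)
open import Data.Nat.ListAction using (sum)
open import Data.Nat.ListAction.Properties using (sum-++)
open import Data.Nat.Properties
  using (+-assoc; +-identityʳ; *-comm; *-distribʳ-+; +-commutativeSemigroup; ≤-<-trans; <ᵇ⇒<; <⇒<ᵇ; m∸n≤m)
import Data.Nat.Tactic.RingSolver as ℕ-Solver
open import Data.Product using (_×_; _,_; proj₁; proj₂)
open import Data.Vec using (_∷_)
open import Function using (_∘_; id)
open import Relation.Binary.PropositionalEquality
  using (_≡_; refl; sym; trans; cong; cong₂; subst; module ≡-Reasoning)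
open import Relation.Nullary.Decidable using (T?)

private
  variable
    A B : Set

+-interchange : ∀ a b c d → (a + b) + (c + d) ≡ (a + c) + (b + d)
+-interchange = CommutativeSemigroupProperties.interchange +-commutativeSemigroup

∧-interchange : ∀ a b c d → (a ∧ b) ∧ (c ∧ d) ≡ (a ∧ c) ∧ (b ∧ d)
∧-interchange =
  CommutativeSemigroupProperties.interchange (CommutativeMonoid.commutativeSemigroup ∧-commutativeMonoid)

boolToℕ : Bool → ℕ
boolToℕ true  = 1
boolToℕ false = 0

boolToℕ-∧ : ∀ b c → boolToℕ (b ∧ c) ≡ (if b then boolToℕ c else 0)
boolToℕ-∧ true  c = refl
boolToℕ-∧ false c = refl

count-∷ : (p : A → Bool) (x : A) (xs : List A) → count p (x ∷ xs) ≡ boolToℕ (p x) + count p xs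
count-∷ p x xs with p x
... | true  = refl
... | false = refl

count-++ : (p : A → Bool) (xs ys : List A) → count p (xs ++ ys) ≡ count p xs + count p ys
count-++ p xs ys = trans (cong length (filter-++ _ xs ys)) (length-++ (filter _ xs))

count-↭ : (p : A → Bool) {xs ys : List A} → xs ↭ ys → count p xs ≡ count p ys
count-↭ p xs↭ys = ↭-length (filter-↭ _ xs↭ys)

count-map : (p : B → Bool) (f : A → B) (xs : List A) → count p (map f xs) ≡ count (p ∘ f) xs
count-map p f []       = refl
count-map p f (x ∷ xs) = trans (count-∷ p (f x) (map f xs))
  (trans (cong (_+_ (boolToℕ (p (f x)))) (count-map p f xs)) (sym (count-∷ (p ∘ f) x xs)))

count-none : {p : A → Bool} {xs : List A} → All (λ x → p x ≡ false) xs → count p xs ≡ 0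
count-none []                                  = refl
count-none {p = p} {x ∷ xs} (px≡false ∷ none) =
  trans (count-∷ p x xs) (cong₂ (λ b n → boolToℕ b + n) px≡false (count-none none))

count-concatMap-pair : (p : B → Bool) (f g : A → B) (xs : List A) →
  count p (concatMap (λ x → f x ∷ g x ∷ []) xs) ≡ count (p ∘ f) xs + count (p ∘ g) xs
count-concatMap-pair p f g []       = refl
count-concatMap-pair p f g (x ∷ xs) = begin
  count p (f x ∷ g x ∷ concatMap _ xs)
    ≡⟨ trans (count-∷ p (f x) _) (cong (_+_ m) (count-∷ p (g x) _)) ⟩
  m + (n + count p (concatMap _ xs))
    ≡⟨ cong (λ k → m + (n + k)) (count-concatMap-pair p f g xs) ⟩
  m + (n + (count (p ∘ f) xs + count (p ∘ g) xs))
    ≡⟨ trans (sym (+-assoc m n _)) (+-interchange m n _ _) ⟩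
  (m + count (p ∘ f) xs) + (n + count (p ∘ g) xs)
    ≡⟨ sym (cong₂ _+_ (count-∷ (p ∘ f) x xs) (count-∷ (p ∘ g) x xs)) ⟩
  count (p ∘ f) (x ∷ xs) + count (p ∘ g) (x ∷ xs) ∎
  where
  open ≡-Reasoning
  m n : ℕ
  m = boolToℕ (p (f x))
  n = boolToℕ (p (g x))

all-cong : {p q : A → Bool} → (∀ x → p x ≡ q x) → (xs : List A) → all p xs ≡ all q xs
all-cong p≗q []       = refl
all-cong p≗q (x ∷ xs) = cong₂ _∧_ (p≗q x) (all-cong p≗q xs)

all-∧ : (p q : A → Bool) (xs : List A) → all (λ x → p x ∧ q x) xs ≡ all p xs ∧ all q xs
all-∧ p q []       = refl
all-∧ p q (x ∷ xs) =
  trans (cong ((p x ∧ q x) ∧_) (all-∧ p q xs)) (∧-interchange (p x) (q x) (all p xs) (all q xs))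

all-applyUpTo-cong : {p q : A → Bool} {f g : ℕ → A} → (∀ i → p (f i) ≡ q (g i)) →
  ∀ n → all p (applyUpTo f n) ≡ all q (applyUpTo g n)
all-applyUpTo-cong pf≗qg zero    = refl
all-applyUpTo-cong pf≗qg (suc n) = cong₂ _∧_ (pf≗qg 0) (all-applyUpTo-cong (pf≗qg ∘ suc) n)

filterᵇ-map : (q : B → Bool) (f : A → B) (xs : List A) → filterᵇ q (map f xs) ≡ map f (filterᵇ (q ∘ f) xs)
filterᵇ-map q f []       = refl
filterᵇ-map q f (x ∷ xs) with q (f x)
... | true  = cong (f x ∷_) (filterᵇ-map q f xs)
... | false = filterᵇ-map q f xs

concatMap-↭ : {f g : A → List B} → (∀ x → f x ↭ g x) → (xs : List A) → concatMap f xs ↭ concatMap g xs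
concatMap-↭ f↭g []       = ↭.refl
concatMap-↭ f↭g (x ∷ xs) = ++⁺ (f↭g x) (concatMap-↭ f↭g xs)

concatMap-++-↭ : (f g : A → List B) (xs : List A) →
  concatMap (λ x → f x ++ g x) xs ↭ concatMap f xs ++ concatMap g xs
concatMap-++-↭ f g []       = ↭.refl
concatMap-++-↭ f g (x ∷ xs) = begin
  (f x ++ g x) ++ concatMap (λ x → f x ++ g x) xs  ↭⟨ ++⁺ˡ (f x ++ g x) (concatMap-++-↭ f g xs) ⟩
  (f x ++ g x) ++ concatMap f xs ++ concatMap g xs ≡⟨ ++-assoc (f x) (g x) _ ⟩
  f x ++ g x ++ concatMap f xs ++ concatMap g xs    ↭⟨ ++⁺ˡ (f x) (shifts (g x) (concatMap f xs)) ⟩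
  f x ++ concatMap f xs ++ g x ++ concatMap g xs    ≡⟨ sym (++-assoc (f x) _ _) ⟩
  (f x ++ concatMap f xs) ++ g x ++ concatMap g xs ∎
  where open PermutationReasoning

-- Sums over all sublists

sumSublists : List A → (List A → ℕ) → ℕ
sumSublists []       f = f []
sumSublists (c ∷ cs) f = sumSublists cs (f ∘ (c ∷_)) + sumSublists cs f

sumSublists-cong : (cs : List A) {f g : List A → ℕ} → (∀ S → f S ≡ g S) → sumSublists cs f ≡ sumSublists cs g
sumSublists-cong []       f≗g = f≗g []
sumSublists-cong (c ∷ cs) f≗g = cong₂ _+_ (sumSublists-cong cs (f≗g ∘ (c ∷_))) (sumSublists-cong cs f≗g)

sumSublists-cong-All : {P : A → Set} {cs : List A} {f g : List A → ℕ} → All P cs →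
  (∀ S → All P S → f S ≡ g S) → sumSublists cs f ≡ sumSublists cs g
sumSublists-cong-All []         f≗g = f≗g [] []
sumSublists-cong-All (pc ∷ pcs) f≗g =
  cong₂ _+_ (sumSublists-cong-All pcs (λ S pS → f≗g _ (pc ∷ pS))) (sumSublists-cong-All pcs f≗g)

sumSublists-zero : (cs : List A) → sumSublists cs (λ _ → 0) ≡ 0
sumSublists-zero []       = refl
sumSublists-zero (c ∷ cs) = cong₂ _+_ (sumSublists-zero cs) (sumSublists-zero cs)

sumSublists-if : (b : Bool) (cs : List A) (f : List A → ℕ) →
  sumSublists cs (λ S → if b then f S else 0) ≡ (if b then sumSublists cs f else 0)
sumSublists-if true  cs f = refl
sumSublists-if false cs f = sumSublists-zero cs

sumSublists-all : (q : A → Bool) (cs : List A) (f : List A → ℕ) →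
  sumSublists cs (λ S → if all q S then f S else 0) ≡ sumSublists (filterᵇ q cs) f
sumSublists-all q []       f = refl
sumSublists-all q (c ∷ cs) f with q c
... | true  = cong₂ _+_ (sumSublists-all q cs (f ∘ (c ∷_))) (sumSublists-all q cs f)
... | false = cong₂ _+_ (sumSublists-zero cs) (sumSublists-all q cs f)

sumSublists-map : (h : A → B) (cs : List A) (f : List B → ℕ) →
  sumSublists (map h cs) f ≡ sumSublists cs (f ∘ map h)
sumSublists-map h []       f = refl
sumSublists-map h (c ∷ cs) f = cong₂ _+_ (sumSublists-map h cs _) (sumSublists-map h cs f)

sumSublists-++ : (xs ys : List A) (f : List A → ℕ) →
  sumSublists (xs ++ ys) f ≡ sumSublists xs (λ S → sumSublists ys (λ T → f (S ++ T)))
sumSublists-++ []       ys f = refl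
sumSublists-++ (x ∷ xs) ys f = cong₂ _+_ (sumSublists-++ xs ys (f ∘ (x ∷_))) (sumSublists-++ xs ys f)

sumSublists-↭ : {cs ds : List A} (f : List A → ℕ) → (∀ {S T} → S ↭ T → f S ≡ f T) →
  cs ↭ ds → sumSublists cs f ≡ sumSublists ds f
sumSublists-↭ f f-↭ ↭.refl = refl
sumSublists-↭ f f-↭ (↭.prep x cs↭ds) =
  cong₂ _+_ (sumSublists-↭ (f ∘ (x ∷_)) (f-↭ ∘ ↭.prep x) cs↭ds) (sumSublists-↭ f f-↭ cs↭ds)
sumSublists-↭ f f-↭ (↭.swap {cs} {ds} x y cs↭ds) =
  trans (+-interchange (Σ cs (f ∘ (x ∷_) ∘ (y ∷_))) (Σ cs (f ∘ (x ∷_))) (Σ cs (f ∘ (y ∷_))) (Σ cs f))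
        (cong₂ _+_ (cong₂ _+_ swapped (IH (f-↭ ∘ ↭.prep y)))
                   (cong₂ _+_ (IH (f-↭ ∘ ↭.prep x)) (IH f-↭)))
  where
  Σ : List A → (List A → ℕ) → ℕ
  Σ = sumSublists
  IH : ∀ {g} → (∀ {S T} → S ↭ T → g S ≡ g T) → Σ cs g ≡ Σ ds g
  IH g-↭ = sumSublists-↭ _ g-↭ cs↭ds
  swapped : Σ cs (f ∘ (x ∷_) ∘ (y ∷_)) ≡ Σ ds (f ∘ (y ∷_) ∘ (x ∷_))
  swapped = trans (sumSublists-cong cs (λ _ → f-↭ (↭.swap x y ↭.refl))) (IH (f-↭ ∘ ↭.prep y ∘ ↭.prep x))
sumSublists-↭ f f-↭ (↭.trans cs↭ds ds↭es) = trans (sumSublists-↭ f f-↭ cs↭ds) (sumSublists-↭ f f-↭ ds↭es)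

sublists : List A → List (List A)
sublists []       = [] ∷ []
sublists (c ∷ cs) = map (c ∷_) (sublists cs) ++ sublists cs

sumSublists-sublists : (cs : List A) (f : List A → ℕ) → sumSublists cs f ≡ sum (map f (sublists cs))
sumSublists-sublists []       f = sym (+-identityʳ (f []))
sumSublists-sublists (c ∷ cs) f = begin
  sumSublists cs (f ∘ (c ∷_)) + sumSublists cs f
    ≡⟨ cong₂ _+_ (sumSublists-sublists cs (f ∘ (c ∷_))) (sumSublists-sublists cs f) ⟩
  sum (map (f ∘ (c ∷_)) (sublists cs)) + sum (map f (sublists cs))
    ≡⟨ cong (λ s → sum s + sum (map f (sublists cs))) (map-∘ (sublists cs)) ⟩
  sum (map f (map (c ∷_) (sublists cs))) + sum (map f (sublists cs))
    ≡⟨ sym (trans (cong sum (map-++ f (map (c ∷_) (sublists cs)) (sublists cs)))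
                  (sum-++ (map f (map (c ∷_) (sublists cs))) _)) ⟩
  sum (map f (sublists (c ∷ cs))) ∎
  where open ≡-Reasoning

sum-map-if : (q : A → Bool) (g : A → ℕ) (xs : List A) →
  sum (map (λ x → if q x then g x else 0) xs) ≡ sum (map g (filterᵇ q xs))
sum-map-if q g []       = refl
sum-map-if q g (x ∷ xs) with q x
... | true  = cong (_+_ (g x)) (sum-map-if q g xs)
... | false = sum-map-if q g xs

count-selected : (cs : List Box) (Q : List Box → Bool) →
  count (Q ∘ selected cs) (allVecs (length cs)) ≡ sumSublists cs (boolToℕ ∘ Q)
count-selected []       Q with Q []
... | true  = refl
... | false = refl
count-selected (c ∷ cs) Q =
  trans (count-concatMap-pair (Q ∘ selected (c ∷ cs)) (true ∷_) (false ∷_) (allVecs (length cs)))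
        (cong₂ _+_ (count-selected cs (Q ∘ (c ∷_))) (count-selected cs Q))

-- Bricks of the 2 × 3 × n box

brick : Box → Bool
brick = congruent 1 2 2

bricks : ℕ → List Box
bricks n = filterᵇ brick (candidates 2 3 n)

boxOf : ℕ × ℕ → ℕ × ℕ → ℕ × ℕ → Box
boxOf (x0 , x1) (y0 , y1) (z0 , z1) = box x0 x1 y0 y1 z0 z1

boxesWithXZ : ℕ × ℕ → List (ℕ × ℕ) → List Box
boxesWithXZ x zs = concatMap (λ y → map (boxOf x y) zs) (intervals 3)

-- candidates 2 3 n is boxesWithZ (intervals n) on the nose.
boxesWithZ : List (ℕ × ℕ) → List Box
boxesWithZ zs = concatMap (λ x → boxesWithXZ x zs) (intervals 2)

shiftZ : ℕ × ℕ → ℕ × ℕ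
shiftZ (z0 , z1) = (suc z0 , suc z1)

liftBox : Box → Box
liftBox (box x0 x1 y0 y1 z0 z1) = box x0 x1 y0 y1 (suc z0) (suc z1)

intervals-suc : ∀ n → intervals (suc n) ≡ map (λ d → (0 , suc d)) (upTo (suc n)) ++ map shiftZ (intervals n)
intervals-suc n = cong (map (λ d → (0 , suc d)) (upTo (suc n)) ++_) (begin
  concatMap (row (suc n)) (applyUpTo suc n)  ≡⟨ cong (concatMap (row (suc n))) (sym (map-applyUpTo id suc n)) ⟩
  concatMap (row (suc n)) (map suc (upTo n)) ≡⟨ concatMap-map (row (suc n)) suc (upTo n) ⟩
  concatMap (row (suc n) ∘ suc) (upTo n)     ≡⟨ concatMap-cong (λ a → map-∘ (upTo (n ∸ a))) (upTo n) ⟩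
  concatMap (map shiftZ ∘ row n) (upTo n)    ≡⟨ sym (map-concatMap shiftZ (row n) (upTo n)) ⟩
  map shiftZ (intervals n)                   ∎)
  where
  open ≡-Reasoning
  row : ℕ → ℕ → List (ℕ × ℕ)
  row k a = map (λ d → (a , a + suc d)) (upTo (k ∸ a))

boxesWithZ-++ : (zs ws : List (ℕ × ℕ)) → boxesWithZ (zs ++ ws) ↭ boxesWithZ zs ++ boxesWithZ ws
boxesWithZ-++ zs ws = ↭-trans
  (concatMap-↭ (λ x → ↭-trans (↭-reflexive (concatMap-cong (λ y → map-++ (boxOf x y) zs ws) (intervals 3)))
                               (concatMap-++-↭ (λ y → map (boxOf x y) zs) (λ y → map (boxOf x y) ws) (intervals 3)))
               (intervals 2))
  (concatMap-++-↭ (λ x → boxesWithXZ x zs) (λ x → boxesWithXZ x ws) (intervals 2))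

boxesWithZ-shiftZ : (zs : List (ℕ × ℕ)) → boxesWithZ (map shiftZ zs) ≡ map liftBox (boxesWithZ zs)
boxesWithZ-shiftZ zs = begin
  concatMap (λ x → boxesWithXZ x (map shiftZ zs)) (intervals 2)
    ≡⟨ concatMap-cong (λ x → trans (concatMap-cong (lift-boxOf x) (intervals 3))
                                   (sym (map-concatMap liftBox (λ y → map (boxOf x y) zs) (intervals 3))))
                      (intervals 2) ⟩
  concatMap (λ x → map liftBox (boxesWithXZ x zs)) (intervals 2)
    ≡⟨ sym (map-concatMap liftBox (λ x → boxesWithXZ x zs) (intervals 2)) ⟩
  map liftBox (boxesWithZ zs) ∎
  where
  open ≡-Reasoning
  lift-boxOf : ∀ x y → map (boxOf x y) (map shiftZ zs) ≡ map liftBox (map (boxOf x y) zs)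
  lift-boxOf x y = trans (sym (map-∘ {g = boxOf x y} {f = shiftZ} zs)) (map-∘ {g = liftBox} {f = boxOf x y} zs)

All-boxesWithZ : {P : Box → Set} {Q : ℕ × ℕ → Set} → (∀ x y {z} → Q z → P (boxOf x y z)) →
  {zs : List (ℕ × ℕ)} → All Q zs → All P (boxesWithZ zs)
All-boxesWithZ P-boxOf Qzs = concat⁺ (map⁺ (universal (λ x →
  concat⁺ (map⁺ (universal (λ y → map⁺ (All.map (P-boxOf x y) Qzs)) (intervals 3)))) (intervals 2)))

tall-not-brick : ∀ d₁ d₂ k → isPermOf d₁ d₂ (3 + k) 1 2 2 ≡ false
tall-not-brick d₁ d₂ k
  rewrite ∧-zeroʳ (d₂ ≡ᵇ 2) | ∧-zeroʳ (d₂ ≡ᵇ 1) | ∧-zeroʳ (d₁ ≡ᵇ 1) | ∧-zeroʳ (d₁ ≡ᵇ 2) = refl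

bottomZ : List (ℕ × ℕ)
bottomZ = (0 , 1) ∷ (0 , 2) ∷ []

bottomBricks : List Box
bottomBricks = filterᵇ brick (boxesWithZ bottomZ)

bricks-↭ : ∀ n → bricks (2 + n) ↭ bottomBricks ++ map liftBox (bricks (1 + n))
bricks-↭ n = begin
  filterᵇ brick (boxesWithZ (intervals (2 + n)))
    ≡⟨ cong (filterᵇ brick ∘ boxesWithZ) (intervals-suc (1 + n)) ⟩
  filterᵇ brick (boxesWithZ (bottomZ ++ tallZ ++ liftedZ))
    ↭⟨ filter-↭ (T? ∘ brick) (↭-trans (boxesWithZ-++ bottomZ (tallZ ++ liftedZ))
                                       (++⁺ˡ (boxesWithZ bottomZ) (boxesWithZ-++ tallZ liftedZ))) ⟩
  filterᵇ brick (boxesWithZ bottomZ ++ boxesWithZ tallZ ++ boxesWithZ liftedZ)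
    ≡⟨ trans (filter-++ (T? ∘ brick) (boxesWithZ bottomZ) (boxesWithZ tallZ ++ boxesWithZ liftedZ))
             (cong (bottomBricks ++_) (filter-++ (T? ∘ brick) (boxesWithZ tallZ) (boxesWithZ liftedZ))) ⟩
  bottomBricks ++ filterᵇ brick (boxesWithZ tallZ) ++ filterᵇ brick (boxesWithZ liftedZ)
    ≡⟨ cong (bottomBricks ++_) (cong₂ _++_ no-tall-bricks lifted-bricks) ⟩
  bottomBricks ++ map liftBox (bricks (1 + n)) ∎
  where
  open PermutationReasoning
  tallZ liftedZ : List (ℕ × ℕ)
  tallZ   = map (λ d → (0 , suc d)) (applyUpTo (suc ∘ suc) n)
  liftedZ = map shiftZ (intervals (1 + n))
  no-tall-bricks : filterᵇ brick (boxesWithZ tallZ) ≡ []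
  no-tall-bricks = filter-none (T? ∘ brick)
    (All-boxesWithZ {Q = λ z → ∀ x y → brick (boxOf x y z) ≡ false}
      (λ x y not-brick → subst T (not-brick x y))
      (map⁺ (applyUpTo⁺₂ (suc ∘ suc) n
        (λ k x y → tall-not-brick (proj₂ x ∸ proj₁ x) (proj₂ y ∸ proj₁ y) k))))
  lifted-bricks : filterᵇ brick (boxesWithZ liftedZ) ≡ map liftBox (bricks (1 + n))
  lifted-bricks = trans (cong (filterᵇ brick) (boxesWithZ-shiftZ (intervals (1 + n))))
                        (filterᵇ-map brick liftBox (candidates 2 3 (1 + n)))

-- Peeling off the bottom layer

cells : ℕ → (ℕ → ℕ → ℕ → Bool) → Bool
cells n P = all (λ i → all (λ j → all (λ l → P i j l) (upTo n)) (upTo 3)) (upTo 2)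

cells-cong : ∀ n {P Q : ℕ → ℕ → ℕ → Bool} → (∀ i j l → P i j l ≡ Q i j l) → cells n P ≡ cells n Q
cells-cong n P≗Q = all-cong (λ i → all-cong (λ j → all-cong (P≗Q i j) (upTo n)) (upTo 3)) (upTo 2)

cover : List Box → ℕ → ℕ → ℕ → ℕ
cover S i j l = count (λ b → containsCell b i j l) S

-- o i j says whether cell (i, j, 0) is already covered by a brick from below; need (o i j) l is then
-- the number of new bricks that must cover cell (i, j, l).
Occupancy : Set
Occupancy = ℕ → ℕ → Bool

need : Bool → ℕ → ℕ
need _     (suc _) = 1
need true  zero    = 0
need false zero    = 1

exactCover : ℕ → Occupancy → List Box → Bool
exactCover n o S = cells n (λ i j l → cover S i j l ≡ᵇ need (o i j) l)

completions : ℕ → Occupancy → ℕ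
completions n o = sumSublists (bricks n) (boolToℕ ∘ exactCover n o)

numTilings-completions : ∀ n → numTilings 2 3 n 1 2 2 ≡ completions n (λ _ _ → false)
numTilings-completions n = begin
  numTilings 2 3 n 1 2 2
    ≡⟨ count-selected (candidates 2 3 n) (isTiling 2 3 n 1 2 2) ⟩
  sumSublists (candidates 2 3 n) (boolToℕ ∘ isTiling 2 3 n 1 2 2)
    ≡⟨ sumSublists-cong (candidates 2 3 n) (λ S → boolToℕ-∧ (all brick S) _) ⟩
  sumSublists (candidates 2 3 n) (λ S → if all brick S then boolToℕ (exactlyOnce S) else 0)
    ≡⟨ sumSublists-all brick (candidates 2 3 n) _ ⟩
  sumSublists (bricks n) (boolToℕ ∘ exactlyOnce)
    ≡⟨ sumSublists-cong (bricks n) (λ S → cong boolToℕ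
         (cells-cong n (λ i j l → cong (cover S i j l ≡ᵇ_) (sym (need-false l))))) ⟩
  completions n (λ _ _ → false) ∎
  where
  open ≡-Reasoning
  exactlyOnce : List Box → Bool
  exactlyOnce S = cells n (λ i j l → cover S i j l ≡ᵇ 1)
  need-false : ∀ l → need false l ≡ 1
  need-false zero    = refl
  need-false (suc l) = refl

-- The cell of layer 1 gets c₁ bricks from the bottom slab and d 0 from the rest; it is covered exactly
-- once iff c₁ ≤ 1 and the rest covers it exactly when the slab does not.
column-split : (o : Bool) (n c₀ c₁ : ℕ) (d e : ℕ → ℕ) →
  e 0 ≡ c₀ → e 1 ≡ c₁ + d 0 → (∀ l → e (2 + l) ≡ d (1 + l)) →
  all (λ l → e l ≡ᵇ need o l) (upTo (2 + n))
    ≡ ((c₀ ≡ᵇ need o 0) ∧ (c₁ ≤ᵇ 1)) ∧ all (λ l → d l ≡ᵇ need (c₁ ≡ᵇ 1) l) (upTo (1 + n))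
column-split o n c₀ c₁ d e e₀ e₁ e≗d = begin
  (e 0 ≡ᵇ need o 0) ∧ ((e 1 ≡ᵇ 1) ∧ rest)
    ≡⟨ cong₂ (λ x y → (x ≡ᵇ need o 0) ∧ ((y ≡ᵇ 1) ∧ rest)) e₀ e₁ ⟩
  (c₀ ≡ᵇ need o 0) ∧ ((c₁ + d 0 ≡ᵇ 1) ∧ rest)
    ≡⟨ cong (λ r → (c₀ ≡ᵇ need o 0) ∧ ((c₁ + d 0 ≡ᵇ 1) ∧ r))
            (all-applyUpTo-cong (λ l → cong (_≡ᵇ 1) (e≗d l)) n) ⟩
  (c₀ ≡ᵇ need o 0) ∧ ((c₁ + d 0 ≡ᵇ 1) ∧ all (λ l → d l ≡ᵇ need (c₁ ≡ᵇ 1) l) (applyUpTo suc n))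
    ≡⟨ layer₁ (c₀ ≡ᵇ need o 0) c₁ (d 0) _ ⟩
  ((c₀ ≡ᵇ need o 0) ∧ (c₁ ≤ᵇ 1)) ∧ all (λ l → d l ≡ᵇ need (c₁ ≡ᵇ 1) l) (upTo (1 + n)) ∎
  where
  open ≡-Reasoning
  rest : Bool
  rest = all (λ l → e l ≡ᵇ need o l) (applyUpTo (suc ∘ suc) n)
  layer₁ : ∀ b c₁ d₀ r →
    b ∧ ((c₁ + d₀ ≡ᵇ 1) ∧ r) ≡ (b ∧ (c₁ ≤ᵇ 1)) ∧ ((d₀ ≡ᵇ need (c₁ ≡ᵇ 1) 0) ∧ r)
  layer₁ false c₁             d₀ r = refl
  layer₁ true  zero           d₀ r = refl
  layer₁ true  (suc zero)     d₀ r = refl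
  layer₁ true  (suc (suc c₁)) d₀ r = refl

containsCell-outsideZ : ∀ b i j l → (not (l <ᵇ Box.z0 b) ∧ (l <ᵇ Box.z1 b)) ≡ false →
  containsCell b i j l ≡ false
containsCell-outsideZ (box x0 x1 y0 y1 z0 z1) i j l outside
  rewrite outside | ∧-zeroʳ (j <ᵇ y1) | ∧-zeroʳ (not (j <ᵇ y0)) | ∧-zeroʳ (i <ᵇ x1) | ∧-zeroʳ (not (i <ᵇ x0))
  = refl

Below₂ : Box → Set
Below₂ b = ∀ l → (2 + l <ᵇ Box.z1 b) ≡ false

cover-++ : ∀ S T i j l → cover (S ++ T) i j l ≡ cover S i j l + cover T i j l
cover-++ S T i j l = count-++ (λ b → containsCell b i j l) S T

cover-below₂ : ∀ {S} → All Below₂ S → ∀ i j l → cover S i j (2 + l) ≡ 0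
cover-below₂ S-below i j l = count-none (All.map (λ {b} below →
  containsCell-outsideZ b i j (2 + l) (trans (cong (not (2 + l <ᵇ Box.z0 b) ∧_) (below l)) (∧-zeroʳ _))) S-below)

cover-liftBox-zero : ∀ S i j → cover (map liftBox S) i j 0 ≡ 0
cover-liftBox-zero S i j = trans (count-map _ liftBox S)
  (count-none (universal (λ b → containsCell-outsideZ (liftBox b) i j 0 refl) S))

cover-liftBox-suc : ∀ S i j l → cover (map liftBox S) i j (suc l) ≡ cover S i j l
cover-liftBox-suc S i j l = count-map _ liftBox S

bottomOK : Occupancy → List Box → Bool
bottomOK o S₀ =
  all (λ i → all (λ j → (cover S₀ i j 0 ≡ᵇ need (o i j) 0) ∧ (cover S₀ i j 1 ≤ᵇ 1)) (upTo 3)) (upTo 2)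

overhang : List Box → Occupancy
overhang S₀ i j = cover S₀ i j 1 ≡ᵇ 1

exactCover-split : ∀ n o S₀ S₁ → All Below₂ S₀ →
  exactCover (2 + n) o (S₀ ++ map liftBox S₁) ≡ bottomOK o S₀ ∧ exactCover (1 + n) (overhang S₀) S₁
exactCover-split n o S₀ S₁ S₀-below =
  trans (all-cong (λ i → trans (all-cong (column i) (upTo 3)) (all-∧ (bottom i) (top i) (upTo 3))) (upTo 2))
        (all-∧ (λ i → all (bottom i) (upTo 3)) (λ i → all (top i) (upTo 3)) (upTo 2))
  where
  bottom top : ℕ → ℕ → Bool
  bottom i j = (cover S₀ i j 0 ≡ᵇ need (o i j) 0) ∧ (cover S₀ i j 1 ≤ᵇ 1)
  top    i j = all (λ l → cover S₁ i j l ≡ᵇ need (overhang S₀ i j) l) (upTo (1 + n))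
  column : ∀ i j → all (λ l → cover (S₀ ++ map liftBox S₁) i j l ≡ᵇ need (o i j) l) (upTo (2 + n))
                   ≡ bottom i j ∧ top i j
  column i j = column-split (o i j) n (cover S₀ i j 0) (cover S₀ i j 1) (λ l → cover S₁ i j l)
    (λ l → cover (S₀ ++ map liftBox S₁) i j l)
    (trans (cover-++ S₀ _ i j 0) (trans (cong (_+_ (cover S₀ i j 0)) (cover-liftBox-zero S₁ i j)) (+-identityʳ _)))
    (trans (cover-++ S₀ _ i j 1) (cong (_+_ (cover S₀ i j 1)) (cover-liftBox-suc S₁ i j 0)))
    (λ l → trans (cover-++ S₀ _ i j (2 + l))
                 (cong₂ _+_ (cover-below₂ S₀-below i j l) (cover-liftBox-suc S₁ i j (1 + l))))

bottomBricks-below₂ : All Below₂ bottomBricks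
bottomBricks-below₂ = filter⁺ (T? ∘ brick)
  (All-boxesWithZ {P = Below₂} {Q = λ z → ∀ l → (2 + l <ᵇ proj₂ z) ≡ false} (λ x y below → below)
    {zs = bottomZ} ((λ l → refl) ∷ (λ l → refl) ∷ []))

exactCover-↭ : ∀ n o {S T} → S ↭ T → exactCover n o S ≡ exactCover n o T
exactCover-↭ n o S↭T =
  cells-cong n (λ i j l → cong (_≡ᵇ need (o i j) l) (count-↭ (λ b → containsCell b i j l) S↭T))

completions-step : ∀ n o → completions (2 + n) o
  ≡ sumSublists bottomBricks (λ S₀ → if bottomOK o S₀ then completions (1 + n) (overhang S₀) else 0)
completions-step n o = begin
  sumSublists (bricks (2 + n)) (boolToℕ ∘ exactCover (2 + n) o)
    ≡⟨ sumSublists-↭ _ (cong boolToℕ ∘ exactCover-↭ (2 + n) o) (bricks-↭ n) ⟩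
  sumSublists (bottomBricks ++ map liftBox (bricks (1 + n))) (boolToℕ ∘ exactCover (2 + n) o)
    ≡⟨ sumSublists-++ bottomBricks (map liftBox (bricks (1 + n))) (boolToℕ ∘ exactCover (2 + n) o) ⟩
  sumSublists bottomBricks (λ S₀ →
    sumSublists (map liftBox (bricks (1 + n))) (boolToℕ ∘ exactCover (2 + n) o ∘ (S₀ ++_)))
    ≡⟨ sumSublists-cong-All bottomBricks-below₂ above ⟩
  sumSublists bottomBricks (λ S₀ → if bottomOK o S₀ then completions (1 + n) (overhang S₀) else 0) ∎
  where
  open ≡-Reasoning
  above : ∀ S₀ → All Below₂ S₀ →
    sumSublists (map liftBox (bricks (1 + n))) (boolToℕ ∘ exactCover (2 + n) o ∘ (S₀ ++_))
      ≡ (if bottomOK o S₀ then completions (1 + n) (overhang S₀) else 0)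
  above S₀ S₀-below = begin
    sumSublists (map liftBox (bricks (1 + n))) (boolToℕ ∘ exactCover (2 + n) o ∘ (S₀ ++_))
      ≡⟨ sumSublists-map liftBox (bricks (1 + n)) _ ⟩
    sumSublists (bricks (1 + n)) (λ S₁ → boolToℕ (exactCover (2 + n) o (S₀ ++ map liftBox S₁)))
      ≡⟨ sumSublists-cong (bricks (1 + n)) (λ S₁ →
           trans (cong boolToℕ (exactCover-split n o S₀ S₁ S₀-below)) (boolToℕ-∧ (bottomOK o S₀) _)) ⟩
    sumSublists (bricks (1 + n)) (λ S₁ → if bottomOK o S₀ then boolToℕ (exactCover (1 + n) (overhang S₀) S₁) else 0)
      ≡⟨ sumSublists-if (bottomOK o S₀) (bricks (1 + n)) _ ⟩
    (if bottomOK o S₀ then completions (1 + n) (overhang S₀) else 0) ∎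

-- Profiles and the transfer matrix

record Profile : Set where
  constructor profile
  field c₀₀ c₀₁ c₀₂ c₁₀ c₁₁ c₁₂ : Bool

occupied : Profile → Occupancy
occupied (profile c₀₀ c₀₁ c₀₂ c₁₀ c₁₁ c₁₂) 0 0 = c₀₀
occupied (profile c₀₀ c₀₁ c₀₂ c₁₀ c₁₁ c₁₂) 0 1 = c₀₁
occupied (profile c₀₀ c₀₁ c₀₂ c₁₀ c₁₁ c₁₂) 0 2 = c₀₂
occupied (profile c₀₀ c₀₁ c₀₂ c₁₀ c₁₁ c₁₂) 1 0 = c₁₀
occupied (profile c₀₀ c₀₁ c₀₂ c₁₀ c₁₁ c₁₂) 1 1 = c₁₁
occupied (profile c₀₀ c₀₁ c₀₂ c₁₀ c₁₁ c₁₂) 1 2 = c₁₂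
occupied _                                 _ _ = false

profileOf : Occupancy → Profile
profileOf o = profile (o 0 0) (o 0 1) (o 0 2) (o 1 0) (o 1 1) (o 1 2)

ways : Profile → ℕ → ℕ
ways p n = completions n (occupied p)

successors : Profile → List Profile
successors p = map (profileOf ∘ overhang) (filterᵇ (bottomOK (occupied p)) (sublists bottomBricks))

-- completions only inspects an occupancy on the 2 × 3 cells, so it agrees with occupied ∘ profileOf.
transfer : ∀ n p → ways p (2 + n) ≡ sum (map (λ q → ways q (1 + n)) (successors p))
transfer n p = begin
  ways p (2 + n)
    ≡⟨ completions-step n (occupied p) ⟩
  sumSublists bottomBricks next
    ≡⟨ sumSublists-sublists bottomBricks next ⟩
  sum (map next (sublists bottomBricks))
    ≡⟨ sum-map-if (bottomOK (occupied p)) (completions (1 + n) ∘ overhang) (sublists bottomBricks) ⟩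
  sum (map (λ S₀ → ways (profileOf (overhang S₀)) (1 + n)) (filterᵇ (bottomOK (occupied p)) (sublists bottomBricks)))
    ≡⟨ cong sum (map-∘ (filterᵇ (bottomOK (occupied p)) (sublists bottomBricks))) ⟩
  sum (map (λ q → ways q (1 + n)) (successors p)) ∎
  where
  open ≡-Reasoning
  next : List Box → ℕ
  next S₀ = if bottomOK (occupied p) S₀ then completions (1 + n) (overhang S₀) else 0

transfer-to : ∀ n p {qs} → successors p ≡ qs → ways p (2 + n) ≡ sum (map (λ q → ways q (1 + n)) qs)
transfer-to n p p→qs = trans (transfer n p) (cong (λ qs → sum (map (λ q → ways q (1 + n)) qs)) p→qs)

empty full strip₀ strip₂ strips₀₁ strips₁₂ : Profile
empty    = profile false false false false false false
full     = profile true  true  true  true  true  true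
strip₀   = profile true  false false true  false false
strip₂   = profile false false true  false false true
strips₀₁ = profile true  true  false true  true  false
strips₁₂ = profile false true  true  false true  true

successors-empty : successors empty ≡ full ∷ full ∷ full ∷ strip₀ ∷ strip₂ ∷ []
successors-empty = refl

successors-full : successors full ≡ empty ∷ []
successors-full = refl

successors-strip₀ : successors strip₀ ≡ strips₁₂ ∷ strips₁₂ ∷ empty ∷ []
successors-strip₀ = refl

successors-strip₂ : successors strip₂ ≡ strips₀₁ ∷ strips₀₁ ∷ empty ∷ []
successors-strip₂ = refl

successors-strips₀₁ : successors strips₀₁ ≡ strip₂ ∷ []
successors-strips₀₁ = refl

successors-strips₁₂ : successors strips₁₂ ≡ strip₀ ∷ []
successors-strips₁₂ = refl

ways-empty : ∀ n → ways empty (2 + n) ≡ 3 * ways full (1 + n) + (ways strip₀ (1 + n) + ways strip₂ (1 + n))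
ways-empty n = trans (transfer-to n empty successors-empty)
                     (three-and-two (ways full (1 + n)) (ways strip₀ (1 + n)) (ways strip₂ (1 + n)))
  where
  three-and-two : ∀ u a b → u + (u + (u + (a + (b + 0)))) ≡ 3 * u + (a + b)
  three-and-two = ℕ-Solver.solve-∀

ways-full : ∀ n → ways full (2 + n) ≡ ways empty (1 + n)
ways-full n = trans (transfer-to n full successors-full) (+-identityʳ (ways empty (1 + n)))

two-and-one : ∀ v e → v + (v + (e + 0)) ≡ 2 * v + e
two-and-one = ℕ-Solver.solve-∀

ways-strip₀ : ∀ n → ways strip₀ (2 + n) ≡ 2 * ways strips₁₂ (1 + n) + ways empty (1 + n)
ways-strip₀ n =
  trans (transfer-to n strip₀ successors-strip₀) (two-and-one (ways strips₁₂ (1 + n)) (ways empty (1 + n)))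

ways-strip₂ : ∀ n → ways strip₂ (2 + n) ≡ 2 * ways strips₀₁ (1 + n) + ways empty (1 + n)
ways-strip₂ n =
  trans (transfer-to n strip₂ successors-strip₂) (two-and-one (ways strips₀₁ (1 + n)) (ways empty (1 + n)))

ways-strips₀₁ : ∀ n → ways strips₀₁ (2 + n) ≡ ways strip₂ (1 + n)
ways-strips₀₁ n = trans (transfer-to n strips₀₁ successors-strips₀₁) (+-identityʳ (ways strip₂ (1 + n)))

ways-strips₁₂ : ∀ n → ways strips₁₂ (2 + n) ≡ ways strip₀ (1 + n)
ways-strips₁₂ n = trans (transfer-to n strips₁₂ successors-strips₁₂) (+-identityʳ (ways strip₀ (1 + n)))

ways-full-suc : ∀ n → ways full (1 + n) ≡ ways empty n
ways-full-suc zero    = refl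
ways-full-suc (suc n) = ways-full n

ways-empty-recurrence : ∀ m → ways empty (4 + m) + 6 * ways empty m ≡ 7 * ways empty (2 + m)
ways-empty-recurrence m = begin
  E (4 + m) + 6 * E m                ≡⟨ cong (_+ 6 * E m) four-steps ⟩
  5 * E (2 + m) + 2 * s + 6 * E m    ≡⟨ regroup (E (2 + m)) (E m) s ⟩
  5 * E (2 + m) + 2 * (3 * E m + s)  ≡⟨ cong (λ x → 5 * E (2 + m) + 2 * x) (sym two-steps) ⟩
  5 * E (2 + m) + 2 * E (2 + m)      ≡⟨ sym (*-distribʳ-+ (E (2 + m)) 5 2) ⟩
  7 * E (2 + m)                      ∎
  where
  open ≡-Reasoning
  E : ℕ → ℕ
  E = ways empty
  s : ℕ
  s = ways strip₀ (1 + m) + ways strip₂ (1 + m)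
  two-steps : E (2 + m) ≡ 3 * E m + s
  two-steps = trans (ways-empty m) (cong (λ u → 3 * u + s) (ways-full-suc m))
  four-steps : E (4 + m) ≡ 5 * E (2 + m) + 2 * s
  four-steps = begin
    E (4 + m)
      ≡⟨ ways-empty (2 + m) ⟩
    3 * ways full (3 + m) + (ways strip₀ (3 + m) + ways strip₂ (3 + m))
      ≡⟨ cong₂ (λ u v → 3 * u + v) (ways-full (1 + m)) (cong₂ _+_ (ways-strip₀ (1 + m)) (ways-strip₂ (1 + m))) ⟩
    3 * E (2 + m) + ((2 * ways strips₁₂ (2 + m) + E (2 + m)) + (2 * ways strips₀₁ (2 + m) + E (2 + m)))
      ≡⟨ cong₂ (λ a b → 3 * E (2 + m) + ((2 * a + E (2 + m)) + (2 * b + E (2 + m))))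
               (ways-strips₁₂ m) (ways-strips₀₁ m) ⟩
    3 * E (2 + m) + ((2 * ways strip₀ (1 + m) + E (2 + m)) + (2 * ways strip₂ (1 + m) + E (2 + m)))
      ≡⟨ collect (E (2 + m)) (ways strip₀ (1 + m)) (ways strip₂ (1 + m)) ⟩
    5 * E (2 + m) + 2 * s ∎
    where
    collect : ∀ e a b → 3 * e + ((2 * a + e) + (2 * b + e)) ≡ 5 * e + 2 * (a + b)
    collect = ℕ-Solver.solve-∀
  regroup : ∀ e₂ e₀ s → 5 * e₂ + 2 * s + 6 * e₀ ≡ 5 * e₂ + 2 * (3 * e₀ + s)
  regroup = ℕ-Solver.solve-∀

boxTilings : ℕ → ℕ
boxTilings n = numTilings 2 3 n 1 2 2

boxTilings-ways : ∀ n → boxTilings n ≡ ways empty n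
boxTilings-ways = numTilings-completions

boxTilings-recurrence : ∀ m → boxTilings (4 + m) + 6 * boxTilings m ≡ 7 * boxTilings (2 + m)
boxTilings-recurrence m = begin
  boxTilings (4 + m) + 6 * boxTilings m
    ≡⟨ cong₂ (λ x y → x + 6 * y) (boxTilings-ways (4 + m)) (boxTilings-ways m) ⟩
  ways empty (4 + m) + 6 * ways empty m
    ≡⟨ ways-empty-recurrence m ⟩
  7 * ways empty (2 + m)
    ≡⟨ cong (7 *_) (sym (boxTilings-ways (2 + m))) ⟩
  7 * boxTilings (2 + m) ∎
  where open ≡-Reasoning

a-suc : ∀ N {b} → (suc N % 3 ≡ᵇ 0) ≡ b → a (suc N) ≡ (if b then boxTilings (2 * (suc N / 3)) else 0)
a-suc N = cong (λ b → if b then boxTilings (2 * (suc N / 3)) else 0)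

a-mod₀ : ∀ q → a (q * 3) ≡ boxTilings (q * 2)
a-mod₀ zero    = refl
a-mod₀ (suc q) = begin
  a (suc q * 3)                    ≡⟨ a-suc (2 + q * 3) (cong (_≡ᵇ 0) (m*n%n≡0 (suc q) 3)) ⟩
  boxTilings (2 * (suc q * 3 / 3)) ≡⟨ cong (λ m → boxTilings (2 * m)) (m*n/n≡m (suc q) 3) ⟩
  boxTilings (2 * suc q)           ≡⟨ cong boxTilings (*-comm 2 (suc q)) ⟩
  boxTilings (suc q * 2)           ∎
  where open ≡-Reasoning

a-mod₁ : ∀ q → a (1 + q * 3) ≡ 0
a-mod₁ q = a-suc (q * 3) (cong (_≡ᵇ 0) ([m+kn]%n≡m%n 1 q 3))

a-mod₂ : ∀ q → a (2 + q * 3) ≡ 0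
a-mod₂ q = a-suc (1 + q * 3) (cong (_≡ᵇ 0) ([m+kn]%n≡m%n 2 q 3))

data Mod₃ : ℕ → Set where
  rem₀ : ∀ q → Mod₃ (q * 3)
  rem₁ : ∀ q → Mod₃ (1 + q * 3)
  rem₂ : ∀ q → Mod₃ (2 + q * 3)

mod₃ : ∀ k → Mod₃ k
mod₃ zero = rem₀ 0
mod₃ (suc k) with mod₃ k
... | rem₀ q = rem₁ q
... | rem₁ q = rem₂ q
... | rem₂ q = rem₀ (suc q)

recurrence-of-zeros : ∀ {x y z} → x ≡ 0 → y ≡ 0 → z ≡ 0 → x + 6 * z ≡ 7 * y
recurrence-of-zeros refl refl refl = refl

-- Matching on the view instead of a 'with' on mod₃ k keeps the goal from being normalised, which would
-- unfold `a` into the brute-force count of tilings.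
a-recurrence-mod₃ : ∀ {k} → Mod₃ k → a (6 + k) + 6 * a k ≡ 7 * a (3 + k)
a-recurrence-mod₃ (rem₀ q) = begin
  a ((2 + q) * 3) + 6 * a (q * 3)
    ≡⟨ cong₂ (λ x y → x + 6 * y) (a-mod₀ (2 + q)) (a-mod₀ q) ⟩
  boxTilings (4 + q * 2) + 6 * boxTilings (q * 2)
    ≡⟨ boxTilings-recurrence (q * 2) ⟩
  7 * boxTilings (2 + q * 2)
    ≡⟨ cong (7 *_) (sym (a-mod₀ (1 + q))) ⟩
  7 * a ((1 + q) * 3) ∎
  where open ≡-Reasoning
a-recurrence-mod₃ (rem₁ q) = recurrence-of-zeros (a-mod₁ (2 + q)) (a-mod₁ (1 + q)) (a-mod₁ q)
a-recurrence-mod₃ (rem₂ q) = recurrence-of-zeros (a-mod₂ (2 + q)) (a-mod₂ (1 + q)) (a-mod₂ q)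

a-recurrence : ∀ k → a (6 + k) + 6 * a k ≡ 7 * a (3 + k)
a-recurrence k = a-recurrence-mod₃ (mod₃ k)

-- Stated through an equation so that each use mentions its argument verbatim: checking a 3 or
-- boxTilings 2 against a differently written numeral unfolds them into the brute-force count.
boxTilings-2 : ∀ {m} → m ≡ 2 → boxTilings m ≡ 5
boxTilings-2 refl = trans (boxTilings-ways 2) (ways-empty 0)

a-3 : ∀ {N} → N ≡ 1 * 3 → a N ≡ 5
a-3 refl = trans (a-mod₀ 1) (boxTilings-2 {1 * 2} refl)

-- The power series identity

denominator : Poly
denominator = polyMul oneMinusZ3 oneMinus6Z3

·ₛ-cong-≤ : (p : Poly) {f g : Series} (N : ℕ) → (∀ i → i ≤ N → f i ≡ g i) → (p ·ₛ f) N ≡ (p ·ₛ g) N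
·ₛ-cong-≤ p N f≗g = cong (foldr ℤ._+_ (+ 0)) (map-cong-local
  (All.map (λ {i} _ → cong (coeffP p i ℤ.*_) (f≗g (N ∸ i) (m∸n≤m N i))) (all-upTo (suc N))))

sum-vanishing : (f : ℕ → ℤ) (h : ℕ → ℕ) → (∀ i → f (h i) ≡ + 0) →
  ∀ k → foldr ℤ._+_ (+ 0) (map f (applyUpTo h k)) ≡ + 0
sum-vanishing f h fh≡0 zero    = refl
sum-vanishing f h fh≡0 (suc k) = cong₂ ℤ._+_ (fh≡0 0) (sum-vanishing f (h ∘ suc) (fh≡0 ∘ suc) k)

denominator-coeff-≥7 : ∀ i → coeffP denominator (7 + i) ≡ + 0
denominator-coeff-≥7 zero    = refl
denominator-coeff-≥7 (suc i) = refl

denominator-·ₛ : (g : Series) → ∀ k →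
  (denominator ·ₛ g) (6 + k) ≡ g (6 + k) ℤ.- + 7 ℤ.* g (3 + k) ℤ.+ + 6 ℤ.* g k
denominator-·ₛ g k =
  trans (collect (g (6 + k)) (g (3 + k)) (g k) _)
        (trans (cong (λ r → g (6 + k) ℤ.- + 7 ℤ.* g (3 + k) ℤ.+ + 6 ℤ.* g k ℤ.+ r)
                     (sum-vanishing _ _ (λ i → cong (ℤ._* g (6 + k ∸ (7 + i))) (denominator-coeff-≥7 i)) k))
               (ℤ.+-identityʳ _))
  where
  collect : ∀ x y z r →
    + 1 ℤ.* x ℤ.+ (+ 0 ℤ.+ (+ 0 ℤ.+ (- (+ 7) ℤ.* y ℤ.+ (+ 0 ℤ.+ (+ 0 ℤ.+ (+ 6 ℤ.* z ℤ.+ r))))))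
      ≡ x ℤ.- + 7 ℤ.* y ℤ.+ + 6 ℤ.* z ℤ.+ r
  collect = ℤ-Solver.solve-∀

initialTerms : Poly
initialTerms = + 1 ∷ + 0 ∷ + 0 ∷ + 5 ∷ + 0 ∷ + 0 ∷ []

low-coefficients : (g : Series) → (∀ i → T (i <ᵇ 6) → g i ≡ coeffP initialTerms i) →
  ∀ N → T (N <ᵇ 6) → (denominator ·ₛ g) N ≡ coeffP oneMinus2Z3 N
low-coefficients g g-initial N N<6 =
  trans (·ₛ-cong-≤ denominator N (λ i i≤N → g-initial i (<⇒<ᵇ (≤-<-trans i≤N (<ᵇ⇒< N 6 N<6)))))
        (initial-product N N<6)
  where
  initial-product : ∀ N → T (N <ᵇ 6) → (denominator ·ₛ coeffP initialTerms) N ≡ coeffP oneMinus2Z3 N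
  initial-product 0 _ = refl
  initial-product 1 _ = refl
  initial-product 2 _ = refl
  initial-product 3 _ = refl
  initial-product 4 _ = refl
  initial-product 5 _ = refl

high-coefficients : (g : Series) → (∀ k → g (6 + k) ℤ.+ + 6 ℤ.* g k ≡ + 7 ℤ.* g (3 + k)) →
  ∀ k → (denominator ·ₛ g) (6 + k) ≡ + 0
high-coefficients g g-recurrence k = begin
  (denominator ·ₛ g) (6 + k)                         ≡⟨ denominator-·ₛ g k ⟩
  g (6 + k) ℤ.- + 7 ℤ.* g (3 + k) ℤ.+ + 6 ℤ.* g k     ≡⟨ regroup (g (6 + k)) (g (3 + k)) (g k) ⟩
  (g (6 + k) ℤ.+ + 6 ℤ.* g k) ℤ.- + 7 ℤ.* g (3 + k)   ≡⟨ cong (ℤ._- + 7 ℤ.* g (3 + k)) (g-recurrence k) ⟩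
  + 7 ℤ.* g (3 + k) ℤ.- + 7 ℤ.* g (3 + k)            ≡⟨ ℤ.+-inverseʳ (+ 7 ℤ.* g (3 + k)) ⟩
  + 0                                                ∎
  where
  open ≡-Reasoning
  regroup : ∀ x y z → x ℤ.- + 7 ℤ.* y ℤ.+ + 6 ℤ.* z ≡ (x ℤ.+ + 6 ℤ.* z) ℤ.- + 7 ℤ.* y
  regroup = ℤ-Solver.solve-∀

rational-series : (g : Series) → (∀ i → T (i <ᵇ 6) → g i ≡ coeffP initialTerms i) →
  (∀ k → g (6 + k) ℤ.+ + 6 ℤ.* g k ≡ + 7 ℤ.* g (3 + k)) →
  ∀ N → (polyMul oneMinusZ3 oneMinus6Z3 ·ₛ g) N ≡ coeffP oneMinus2Z3 N
rational-series g g-initial g-recurrence (suc (suc (suc (suc (suc (suc k)))))) = high-coefficients g g-recurrence k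
rational-series g g-initial g-recurrence 0 = low-coefficients g g-initial 0 _
rational-series g g-initial g-recurrence 1 = low-coefficients g g-initial 1 _
rational-series g g-initial g-recurrence 2 = low-coefficients g g-initial 2 _
rational-series g g-initial g-recurrence 3 = low-coefficients g g-initial 3 _
rational-series g g-initial g-recurrence 4 = low-coefficients g g-initial 4 _
rational-series g g-initial g-recurrence 5 = low-coefficients g g-initial 5 _

pos-recurrence : ∀ {x y z} → x + 6 * z ≡ 7 * y → + x ℤ.+ + 6 ℤ.* + z ≡ + 7 ℤ.* + y
pos-recurrence {x} {y} {z} eq = begin
  + x ℤ.+ + 6 ℤ.* + z ≡⟨ cong (λ r → + x ℤ.+ r) (sym (ℤ.pos-* 6 z)) ⟩
  + (x + 6 * z)       ≡⟨ cong +_ eq ⟩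
  + (7 * y)           ≡⟨ ℤ.pos-* 7 y ⟩
  + 7 ℤ.* + y         ∎
  where open ≡-Reasoning

genA-initial : ∀ i → T (i <ᵇ 6) → genA i ≡ coeffP initialTerms i
genA-initial 0     _ = refl
genA-initial 1     _ = refl
genA-initial 2     _ = refl
genA-initial i@3   _ = cong +_ (a-3 {i} refl)
genA-initial 4     _ = refl
genA-initial 5     _ = refl

mainTheorem14 : (N : ℕ) →
    (polyMul oneMinusZ3 oneMinus6Z3 ·ₛ genA) N ≡ coeffP oneMinus2Z3 N
mainTheorem14 = rational-series genA genA-initial (λ k → pos-recurrence {a (6 + k)} {a (3 + k)} {a k} (a-recurrence k))
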